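{- Let $S$ be a set of nonnegative integers with $0,1\in S$. Let $e_1$ be a positive integer and $e_2,e_3$ nonnegative integers, and let $\mathbf{a}=\mathbf{1}^{e_1}\mathbf{2}^{e_2}\mathbf{3}^{e_3}$. Assume that $V_S(\mathbf{a})=\mathbb{N}_0$. Then for every integer $n\ge 2e_3+3$, the vector $$\mathbf{b}=\mathbf{n}^{e_1}\,(\mathbf{n+1})^1\,(\mathbf{n+2})^1\cdots(\mathbf{2n-1})^1\,(\mathbf{2n})^{e_2}$$ satisfies $V'_S(\mathbf{b})=\mathcal T(n)$, i.e. $\mathbf{b}$ is tight $\mathcal T(n)$-universal with respect to $S$.
   Context: $\mathbb{N}_0$ denotes the set of nonnegative integers. For a vector $\mathbf{a}=(a_1,\dots,a_k)$ of positive integers and a set $S$ of nonnegative integers, $V_S(\mathbf{a})=\{a_1s_1+\cdots+a_ks_k : s_i\in S\}$ and $V'_S(\mathbf{a})=V_S(\mathbf{a})\setminus\{0\}$. For a positive integer $n$, $\mathcal T(n)$ is the set of integers greater than or equal to $n$. The notation $\mathbf{n_1}^{e_1}\mathbf{n_2}^{e_2}\cdots\mathbf{n_r}^{e_r}$ denotes the vector $(n_1,\dots,n_1,n_2,\dots,n_2,\dots,n_r,\dots,n_r)$ in which each $n_i$ is repeated $e_i$ times. -}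

module Defs where

open import Data.Nat using (ℕ; zero; suc; _+_; _*_; _∸_; _≤_)
open import Data.List using (List; []; _∷_; _++_; replicate; length; zipWith; map; upTo)
open import Data.Nat.ListAction using (sum)
open import Data.List.Relation.Unary.All using (All)
open import Data.Product using (Σ; ∃; _×_; _,_)
open import Relation.Binary.PropositionalEquality using (_≡_; _≢_)

NatSet : Set₁
NatSet = ℕ → Set

InV : NatSet → List ℕ → ℕ → Set
InV S a m = Σ (List ℕ) λ s → (length s ≡ length a) × All S s × (sum (zipWith _*_ a s) ≡ m)

InV' : NatSet → List ℕ → ℕ → Set
InV' S a m = InV S a m × (m ≢ 0)

aVec : ℕ → ℕ → ℕ → List ℕ
aVec e₁ e₂ e₃ = replicate e₁ 1 ++ replicate e₂ 2 ++ replicate e₃ 3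

-- n^{e1} (n+1)^1 (n+2)^1 ⋯ (2n-1)^1 (2n)^{e2}
-- the middle block is [n+1, …, 2n-1] = map (λ i → n + 1 + i) [0 … n-2]
bVec : ℕ → ℕ → ℕ → List ℕ
bVec n e₁ e₂ = replicate e₁ n ++ map (λ i → n + suc i) (upTo (n ∸ 1)) ++ replicate e₂ (n + n)

-- Every entry of b is at least n, so every nonzero element of V_S(b) is at least n.
-- Conversely, write m ≥ n as n q or as n q + w j, where w j = n + 1 + j (j ≤ n − 2) is
-- a middle weight, and represent q = Σ s₁ + 2 Σ s₂ + 3 Σ s₃ over a. The blocks n and 2n
-- of b take s₁ and s₂ unchanged. The middle weights satisfy w i + w (n − 2 − i) = 3n, so
-- each entry of s₃ is placed both at i < e₃ and at its mirror n − 2 − i; since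
-- n − 2 ≥ 2 e₃ + 1 the two ends do not meet, and every middle coefficient is a single
-- element of S or 0. For n q + w j, a 0 is first inserted into s₃ at min (j, n − 2 − j),
-- which frees both w j and its mirror, and w j receives the coefficient 1.

module Submission where

open import Defs
open import Data.Nat using (ℕ; zero; suc; _+_; _*_; _∸_; _≤_; _<_; _⊓_; z≤n; s≤s; z<s; s<s; NonZero; _≟_; _≤?_; _%_; _/_)
open import Data.Nat.Properties
open import Data.Nat.DivMod using (m≡m%n+[m/n]*n; m%n<n)
open import Data.Nat.ListAction using (sum)
open import Data.Nat.Tactic.RingSolver using (solve-∀)
open import Data.List using (List; []; _∷_; _++_; replicate; length; zipWith; map; upTo; applyUpTo)
open import Data.List.Properties using (length-++; length-map; length-replicate; map-replicate)
open import Data.List.Relation.Unary.All using (All; []; _∷_)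
open import Data.List.Relation.Unary.All.Properties using (++⁺; map⁺; replicate⁺; applyUpTo⁺₂)
open import Data.Product using (∃; ∃₂; _×_; _,_; swap)
open import Data.Sum using (_⊎_; inj₁; inj₂)
open import Function using (_∘_)
open import Function.Bundles using (_⇔_; mk⇔)
open import Relation.Binary.PropositionalEquality
open import Relation.Nullary using (yes; no; contradiction)

∑< : ℕ → (ℕ → ℕ) → ℕ
∑< zero    f = 0
∑< (suc k) f = f 0 + ∑< k (f ∘ suc)

syntax ∑< k (λ i → e) = ∑[ i < k ] e

∑-cong : ∀ k {f g : ℕ → ℕ} → (∀ {i} → i < k → f i ≡ g i) → ∑< k f ≡ ∑< k g
∑-cong zero    f≗g = refl
∑-cong (suc k) f≗g = cong₂ _+_ (f≗g z<s) (∑-cong k (f≗g ∘ s<s))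

∑-zero : ∀ k → ∑[ i < k ] 0 ≡ 0
∑-zero zero    = refl
∑-zero (suc k) = ∑-zero k

∑-distrib-+ : ∀ k (f g : ℕ → ℕ) → ∑[ i < k ] (f i + g i) ≡ ∑< k f + ∑< k g
∑-distrib-+ zero    f g = refl
∑-distrib-+ (suc k) f g =
  trans (cong (f 0 + g 0 +_) (∑-distrib-+ k (f ∘ suc) (g ∘ suc))) (interchange (f 0) (g 0) _ _)
  where
  interchange : ∀ a b c d → a + b + (c + d) ≡ a + c + (b + d)
  interchange = solve-∀

∑-*ˡ : ∀ k c (f : ℕ → ℕ) → ∑[ i < k ] (c * f i) ≡ c * ∑< k f
∑-*ˡ zero    c f = sym (*-zeroʳ c)
∑-*ˡ (suc k) c f = trans (cong (c * f 0 +_) (∑-*ˡ k c (f ∘ suc))) (sym (*-distribˡ-+ c (f 0) _))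

∑-snoc : ∀ k (f : ℕ → ℕ) → ∑< (suc k) f ≡ ∑< k f + f k
∑-snoc zero    f = +-comm (f 0) 0
∑-snoc (suc k) f = trans (cong (f 0 +_) (∑-snoc k (f ∘ suc))) (sym (+-assoc (f 0) _ _))

∑-reflect : ∀ k (f : ℕ → ℕ) → ∑< k f ≡ ∑[ i < k ] f (k ∸ suc i)
∑-reflect zero    f = refl
∑-reflect (suc k) f = begin
  f 0 + ∑< k (f ∘ suc)                          ≡⟨ cong (f 0 +_) (∑-reflect k (f ∘ suc)) ⟩
  f 0 + ∑[ i < k ] f (suc (k ∸ suc i))          ≡⟨ cong (f 0 +_) (∑-cong k (cong f ∘ sym ∘ +-∸-assoc 1)) ⟩
  f 0 + ∑[ i < k ] f (k ∸ i)                    ≡⟨ +-comm (f 0) _ ⟩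
  ∑[ i < k ] f (k ∸ i) + f 0                    ≡⟨ cong (λ j → ∑[ i < k ] f (k ∸ i) + f j) (sym (n∸n≡0 k)) ⟩
  ∑[ i < k ] f (k ∸ i) + f (k ∸ k)              ≡⟨ sym (∑-snoc k (λ i → f (k ∸ i))) ⟩
  ∑[ i < suc k ] f (k ∸ i)                      ∎
  where open ≡-Reasoning

δ : ℕ → ℕ → ℕ
δ zero    zero    = 1
δ zero    (suc _) = 0
δ (suc _) zero    = 0
δ (suc j) (suc i) = δ j i

δ-refl : ∀ j → δ j j ≡ 1
δ-refl zero    = refl
δ-refl (suc j) = δ-refl j

δ-≢ : ∀ j i → j ≢ i → δ j i ≡ 0
δ-≢ zero    zero    j≢i = contradiction refl j≢i
δ-≢ zero    (suc i) _   = refl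
δ-≢ (suc j) zero    _   = refl
δ-≢ (suc j) (suc i) j≢i = δ-≢ j i (j≢i ∘ cong suc)

∑-δ : ∀ k (f : ℕ → ℕ) {j} → j < k → ∑[ i < k ] (f i * δ j i) ≡ f j
∑-δ (suc k) f {zero} _ = begin
  f 0 * 1 + ∑[ i < k ] (f (suc i) * 0)  ≡⟨ cong (f 0 * 1 +_) (∑-cong k (λ {i} _ → *-zeroʳ (f (suc i)))) ⟩
  f 0 * 1 + ∑[ i < k ] 0                ≡⟨ cong₂ _+_ (*-identityʳ (f 0)) (∑-zero k) ⟩
  f 0 + 0                               ≡⟨ +-identityʳ (f 0) ⟩
  f 0                                   ∎
  where open ≡-Reasoning
∑-δ (suc k) f {suc j} (s<s j<k) =
  trans (cong (_+ ∑[ i < k ] (f (suc i) * δ j i)) (*-zeroʳ (f 0))) (∑-δ k (f ∘ suc) j<k)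

_∙_ : List ℕ → List ℕ → ℕ
a ∙ s = sum (zipWith _*_ a s)

∙-++ : ∀ a₁ {a₂ s₁ s₂} → length s₁ ≡ length a₁ → (a₁ ++ a₂) ∙ (s₁ ++ s₂) ≡ a₁ ∙ s₁ + a₂ ∙ s₂
∙-++ []       {s₁ = []}     _   = refl
∙-++ (x ∷ a₁) {s₁ = y ∷ s₁} len =
  trans (cong (x * y +_) (∙-++ a₁ (suc-injective len))) (sym (+-assoc (x * y) _ _))

map-*-∙ : ∀ c a s → map (c *_) a ∙ s ≡ c * (a ∙ s)
map-*-∙ c []      _       = sym (*-zeroʳ c)
map-*-∙ c (_ ∷ _) []      = sym (*-zeroʳ c)
map-*-∙ c (x ∷ a) (y ∷ s) = begin
  c * x * y + map (c *_) a ∙ s  ≡⟨ cong₂ _+_ (*-assoc c x y) (map-*-∙ c a s) ⟩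
  c * (x * y) + c * (a ∙ s)     ≡⟨ sym (*-distribˡ-+ c (x * y) _) ⟩
  c * (x * y + a ∙ s)           ∎
  where open ≡-Reasoning

replicate-∙ : ∀ k c s → length s ≡ k → replicate k c ∙ s ≡ c * sum s
replicate-∙ zero    c []      _   = sym (*-zeroʳ c)
replicate-∙ (suc k) c (x ∷ s) len =
  trans (cong (c * x +_) (replicate-∙ k c s (suc-injective len))) (sym (*-distribˡ-+ c x _))

map-applyUpTo-∙ : ∀ (f g h : ℕ → ℕ) k →
  map f (applyUpTo h k) ∙ map g (applyUpTo h k) ≡ ∑[ i < k ] (f (h i) * g (h i))
map-applyUpTo-∙ f g h zero    = refl
map-applyUpTo-∙ f g h (suc k) = cong (f (h 0) * g (h 0) +_) (map-applyUpTo-∙ f g (h ∘ suc) k)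

∙-≥ : ∀ {n a} s → All (n ≤_) a → a ∙ s ≡ 0 ⊎ n ≤ a ∙ s
∙-≥ _             []         = inj₁ refl
∙-≥ []            (_ ∷ _)    = inj₁ refl
∙-≥ {a = x ∷ _} (zero  ∷ s) (_ ∷ ≥n) rewrite *-zeroʳ x = ∙-≥ s ≥n
∙-≥ {a = x ∷ _} (suc y ∷ s) (n≤x ∷ _) =
  inj₂ (≤-trans n≤x (≤-trans (m≤m*n x (suc y)) (m≤m+n (x * suc y) _)))

entry : List ℕ → ℕ → ℕ
entry []      _       = 0
entry (x ∷ _) zero    = x
entry (_ ∷ l) (suc i) = entry l i

entry-beyond : ∀ l {i} → length l ≤ i → entry l i ≡ 0
entry-beyond []      _         = refl
entry-beyond (_ ∷ l) (s≤s l≤i) = entry-beyond l l≤i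

∑-entry : ∀ l k → length l ≤ k → ∑< k (entry l) ≡ sum l
∑-entry []      k       _         = ∑-zero k
∑-entry (x ∷ l) (suc k) (s≤s l≤k) = cong (x +_) (∑-entry l k l≤k)

insertZero : ℕ → List ℕ → List ℕ
insertZero zero    l       = 0 ∷ l
insertZero (suc p) []      = []
insertZero (suc p) (x ∷ l) = x ∷ insertZero p l

sum-insertZero : ∀ p l → sum (insertZero p l) ≡ sum l
sum-insertZero zero    l       = refl
sum-insertZero (suc p) []      = refl
sum-insertZero (suc p) (x ∷ l) = cong (x +_) (sum-insertZero p l)

length-insertZero : ∀ p l → length (insertZero p l) ≤ suc (length l)
length-insertZero zero    l       = ≤-refl
length-insertZero (suc p) []      = z≤n
length-insertZero (suc p) (x ∷ l) = s≤s (length-insertZero p l)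

entry-insertZero : ∀ p l → entry (insertZero p l) p ≡ 0
entry-insertZero zero    l       = refl
entry-insertZero (suc p) []      = refl
entry-insertZero (suc p) (x ∷ l) = entry-insertZero p l

insertZero-clears : ∀ {i j} l → i ≤ j → length l + length l < i + j →
  entry (insertZero i l) i ≡ 0 × entry (insertZero i l) j ≡ 0
insertZero-clears {i} {j} l i≤j short =
  entry-insertZero i l , entry-beyond (insertZero i l) (≤-trans (length-insertZero i l) l<j)
  where
  l<j : length l < j
  l<j = ≰⇒> λ j≤l → <⇒≱ short (+-mono-≤ (≤-trans i≤j j≤l) j≤l)

insertZero-⊓-clears : ∀ i j l → length l + length l < i + j →
  entry (insertZero (i ⊓ j) l) i ≡ 0 × entry (insertZero (i ⊓ j) l) j ≡ 0
insertZero-⊓-clears i j l short with ≤-total i j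
... | inj₁ i≤j rewrite m≤n⇒m⊓n≡m i≤j = insertZero-clears l i≤j short
... | inj₂ j≤i rewrite m≥n⇒m⊓n≡n j≤i =
  swap (insertZero-clears l j≤i (subst (length l + length l <_) (+-comm i j) short))

module _ {S : NatSet} where

  S-+ : ∀ {x y} → x ≡ 0 ⊎ y ≡ 0 → S x → S y → S (x + y)
  S-+ (inj₁ refl) _  Sy = Sy
  S-+ (inj₂ refl) Sx _  = subst S (sym (+-identityʳ _)) Sx

  All-entry : S 0 → ∀ {l} → All S l → ∀ i → S (entry l i)
  All-entry S0 []        _       = S0
  All-entry S0 (Sx ∷ _)  zero    = Sx
  All-entry S0 (_  ∷ Sl) (suc i) = All-entry S0 Sl i

  All-insertZero : S 0 → ∀ p {l} → All S l → All S (insertZero p l)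
  All-insertZero S0 zero    Sl        = S0 ∷ Sl
  All-insertZero S0 (suc p) []        = []
  All-insertZero S0 (suc p) (Sx ∷ Sl) = Sx ∷ All-insertZero S0 p Sl

  InV-++ : ∀ a b {x y} → InV S a x → InV S b y → InV S (a ++ b) (x + y)
  InV-++ a b (s , ls , Ss , refl) (t , lt , St , refl) =
    s ++ t , trans (length-++ s) (trans (cong₂ _+_ ls lt) (sym (length-++ a))) , ++⁺ Ss St , ∙-++ a ls

  InV-++⁻ : ∀ a {b z} → InV S (a ++ b) z → ∃₂ λ x y → InV S a x × InV S b y × x + y ≡ z
  InV-++⁻ []      {z = z} h = 0 , z , ([] , refl , [] , refl) , h , refl
  InV-++⁻ (c ∷ a) (y ∷ s , len , Sy ∷ Ss , refl) with InV-++⁻ a (s , suc-injective len , Ss , refl)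
  ... | x , x′ , (s₁ , l₁ , S₁ , eq₁) , hb , eq =
    c * y + x , x′ , (y ∷ s₁ , cong suc l₁ , Sy ∷ S₁ , cong (c * y +_) eq₁) , hb ,
    trans (+-assoc (c * y) x x′) (cong (c * y +_) eq)

  InV-scale : ∀ c a {x} → InV S a x → InV S (map (c *_) a) (c * x)
  InV-scale c a (s , ls , Ss , refl) = s , trans ls (sym (length-map (c *_) a)) , Ss , map-*-∙ c a s

  InV-replicate⁻ : ∀ k {c x} → InV S (replicate k c) x → ∃ λ s → All S s × length s ≡ k × c * sum s ≡ x
  InV-replicate⁻ k {c} (s , ls , Ss , refl) =
    s , Ss , trans ls (length-replicate k) , sym (replicate-∙ k c s (trans ls (length-replicate k)))

  InV'-≥ : ∀ {n a m} → All (n ≤_) a → InV' S a m → n ≤ m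
  InV'-≥ ≥n ((s , _ , _ , refl) , m≢0) with ∙-≥ s ≥n
  ... | inj₁ m≡0 = contradiction m≡0 m≢0
  ... | inj₂ n≤m = n≤m

≥-divisor-cases : ∀ n .{{_ : NonZero n}} {m} → n ≤ m →
  (∃ λ q → m ≡ n * q) ⊎ (∃₂ λ q r → suc r < n × m ≡ n * q + (n + suc r))
≥-divisor-cases n {m} n≤m with m % n | m / n | m≡m%n+[m/n]*n m n | m%n<n m n
... | zero  | q     | eq | _   = inj₁ (q , trans eq (*-comm q n))
... | suc r | zero  | eq | r<n = contradiction (subst (n ≤_) (trans eq (+-identityʳ (suc r))) n≤m) (<⇒≱ r<n)
... | suc r | suc q | eq | r<n = inj₂ (q , r , r<n , trans eq (rearrange n q r))
  where
  rearrange : ∀ n q r → suc r + suc q * n ≡ n * q + (n + suc r)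
  rearrange = solve-∀

module Middle (K : ℕ) where

  n : ℕ
  n = suc (suc K)

  w : ℕ → ℕ
  w i = n + suc i

  middle : List ℕ
  middle = map w (upTo (suc K))

  bVec-≥ : ∀ e₁ e₂ → All (n ≤_) (bVec n e₁ e₂)
  bVec-≥ e₁ e₂ = ++⁺ (replicate⁺ e₁ ≤-refl)
    (++⁺ (map⁺ (applyUpTo⁺₂ _ _ (λ i → m≤m+n n (suc i)))) (replicate⁺ e₂ (m≤m+n n n)))

  w-mirror : ∀ {i} → i ≤ K → w i + w (K ∸ i) ≡ 3 * n
  w-mirror {i} i≤K = begin
    n + suc i + (n + suc (K ∸ i))    ≡⟨ regroup n i (K ∸ i) ⟩
    n + n + suc (suc (i + (K ∸ i)))  ≡⟨ cong (λ k → n + n + suc (suc k)) (m+[n∸m]≡n i≤K) ⟩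
    n + n + n                        ≡⟨ triple n ⟩
    3 * n                            ∎
    where
    open ≡-Reasoning
    triple : ∀ n → n + n + n ≡ 3 * n
    triple = solve-∀
    regroup : ∀ n i j → n + suc i + (n + suc j) ≡ n + n + suc (suc (i + j))
    regroup = solve-∀

  mirrored : List ℕ → ℕ → ℕ
  mirrored l i = entry l i + entry l (K ∸ i)

  ∑-w-mirrored : ∀ l → length l ≤ suc K → ∑[ i < suc K ] (w i * mirrored l i) ≡ 3 * n * sum l
  ∑-w-mirrored l l≤ = begin
    ∑[ i < suc K ] (w i * mirrored l i)
      ≡⟨ ∑-cong (suc K) (λ {i} _ → *-distribˡ-+ (w i) (u i) (u (K ∸ i))) ⟩
    ∑[ i < suc K ] (w i * u i + w i * u (K ∸ i))
      ≡⟨ ∑-distrib-+ (suc K) (λ i → w i * u i) (λ i → w i * u (K ∸ i)) ⟩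
    ∑[ i < suc K ] (w i * u i) + ∑[ i < suc K ] (w i * u (K ∸ i))
      ≡⟨ cong (direct +_) (∑-reflect (suc K) (λ i → w i * u (K ∸ i))) ⟩
    ∑[ i < suc K ] (w i * u i) + ∑[ i < suc K ] (w (K ∸ i) * u (K ∸ (K ∸ i)))
      ≡⟨ cong (direct +_) (∑-cong (suc K) (λ {i} i<K → cong (λ j → w (K ∸ i) * u j) (m∸[m∸n]≡n (≤-pred i<K)))) ⟩
    ∑[ i < suc K ] (w i * u i) + ∑[ i < suc K ] (w (K ∸ i) * u i)
      ≡⟨ sym (∑-distrib-+ (suc K) (λ i → w i * u i) (λ i → w (K ∸ i) * u i)) ⟩
    ∑[ i < suc K ] (w i * u i + w (K ∸ i) * u i)
      ≡⟨ ∑-cong (suc K) (λ {i} i<K → trans (sym (*-distribʳ-+ (u i) (w i) _)) (cong (_* u i) (w-mirror (≤-pred i<K)))) ⟩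
    ∑[ i < suc K ] (3 * n * u i)
      ≡⟨ ∑-*ˡ (suc K) (3 * n) u ⟩
    3 * n * ∑< (suc K) u
      ≡⟨ cong (3 * n *_) (∑-entry l (suc K) l≤) ⟩
    3 * n * sum l
      ∎
    where
    open ≡-Reasoning
    u : ℕ → ℕ
    u = entry l
    direct : ℕ
    direct = ∑[ i < suc K ] (w i * u i)

  module _ {S : NatSet} (S0 : S 0) where

    mirrored-S : ∀ {l} → All S l → length l + length l ≤ suc K → ∀ i → S (mirrored l i)
    mirrored-S {l} Sl fits i = S-+ {S = S} one-is-zero (All-entry S0 Sl i) (All-entry S0 Sl (K ∸ i))
      where
      one-is-zero : entry l i ≡ 0 ⊎ entry l (K ∸ i) ≡ 0
      one-is-zero with length l ≤? i
      ... | yes l≤i = inj₁ (entry-beyond l l≤i)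
      ... | no  l≰i = inj₂ (entry-beyond l
              (m+n≤o⇒m≤o∸n (length l) (≤-pred (<-≤-trans (+-monoʳ-< (length l) (≰⇒> l≰i)) fits))))

    InV-middle : (c : ℕ → ℕ) → (∀ i → S (c i)) → InV S middle (∑[ i < suc K ] (w i * c i))
    InV-middle c Sc =
      map c (upTo (suc K)) ,
      trans (length-map c (upTo (suc K))) (sym (length-map w (upTo (suc K)))) ,
      map⁺ (applyUpTo⁺₂ {P = S ∘ c} (λ i → i) (suc K) Sc) ,
      map-applyUpTo-∙ w c (λ i → i) (suc K)

    InV-middle-mirrored : ∀ {l} → All S l → length l + length l ≤ suc K →
      InV S middle (3 * n * sum l)
    InV-middle-mirrored {l} Sl fits =
      subst (InV S middle) (∑-w-mirrored l (m+n≤o⇒m≤o (length l) fits))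
        (InV-middle (mirrored l) (mirrored-S Sl fits))

    InV-middle-mirrored+w : S 1 → ∀ {l} → All S l → length l + length l ≤ suc K →
      ∀ {j} → j ≤ K → entry l j ≡ 0 → entry l (K ∸ j) ≡ 0 → InV S middle (3 * n * sum l + w j)
    InV-middle-mirrored+w S1 {l} Sl fits {j} j≤K lⱼ≡0 lₖ₋ⱼ≡0 =
      subst (InV S middle) total (InV-middle c Sc)
      where
      c : ℕ → ℕ
      c i = mirrored l i + δ j i
      Sc : ∀ i → S (c i)
      Sc i with j ≟ i
      ... | yes refl = S-+ {S = S} (inj₁ (cong₂ _+_ lⱼ≡0 lₖ₋ⱼ≡0)) (mirrored-S Sl fits j)
                         (subst S (sym (δ-refl j)) S1)
      ... | no  j≢i  = S-+ {S = S} (inj₂ (δ-≢ j i j≢i)) (mirrored-S Sl fits i)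
                         (subst S (sym (δ-≢ j i j≢i)) S0)
      total : ∑[ i < suc K ] (w i * c i) ≡ 3 * n * sum l + w j
      total = begin
        ∑[ i < suc K ] (w i * c i)
          ≡⟨ ∑-cong (suc K) (λ {i} _ → *-distribˡ-+ (w i) (mirrored l i) (δ j i)) ⟩
        ∑[ i < suc K ] (w i * mirrored l i + w i * δ j i)
          ≡⟨ ∑-distrib-+ (suc K) (λ i → w i * mirrored l i) (λ i → w i * δ j i) ⟩
        ∑[ i < suc K ] (w i * mirrored l i) + ∑[ i < suc K ] (w i * δ j i)
          ≡⟨ cong₂ _+_ (∑-w-mirrored l (m+n≤o⇒m≤o (length l) fits)) (∑-δ (suc K) w (s≤s j≤K)) ⟩
        3 * n * sum l + w j
          ∎
        where open ≡-Reasoning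

module Construction (S : NatSet) (S0 : S 0) (S1 : S 1) (e₁ e₂ e₃ : ℕ)
  (a-universal : ∀ t → InV S (aVec e₁ e₂ e₃) t) (K : ℕ) (2e₃<K : e₃ + e₃ < K) where

  open Middle K

  InV-bVec-via-aVec : ∀ {x} → (∀ {l} → All S l → length l ≡ e₃ → InV S middle (3 * n * sum l + x)) →
    ∀ t → InV S (bVec n e₁ e₂) (n * t + x)
  InV-bVec-via-aVec {x} mid t with InV-++⁻ (replicate e₁ 1) (a-universal t)
  ... | t₁ , t₂₃ , h₁ , h₂₃ , refl with InV-++⁻ (replicate e₂ 2) h₂₃
  ... | t₂ , t₃ , h₂ , h₃ , refl with InV-replicate⁻ e₃ h₃
  ... | s₃ , S₃ , len₃ , refl =
    subst (InV S (bVec n e₁ e₂)) (collect n t₁ t₂ (sum s₃) x)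
      (InV-++ (replicate e₁ n) _ block₁ (InV-++ middle (replicate e₂ (n + n)) (mid S₃ len₃) block₂))
    where
    block₁ : InV S (replicate e₁ n) (n * t₁)
    block₁ = subst (λ a → InV S a (n * t₁))
      (trans (map-replicate (n *_) e₁ 1) (cong (replicate e₁) (*-identityʳ n)))
      (InV-scale n (replicate e₁ 1) h₁)
    block₂ : InV S (replicate e₂ (n + n)) (n * t₂)
    block₂ = subst (λ a → InV S a (n * t₂))
      (trans (map-replicate (n *_) e₂ 2) (cong (replicate e₂) (trans (*-comm n 2) (cong (n +_) (+-identityʳ n)))))
      (InV-scale n (replicate e₂ 2) h₂)
    collect : ∀ n t₁ t₂ u x → n * t₁ + (3 * n * u + x + n * t₂) ≡ n * (t₁ + (t₂ + 3 * u)) + x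
    collect = solve-∀

  InV-bVec-multiple : ∀ q → InV S (bVec n e₁ e₂) (n * q)
  InV-bVec-multiple q =
    subst (InV S (bVec n e₁ e₂)) (+-identityʳ (n * q)) (InV-bVec-via-aVec mirrored-s₃ q)
    where
    mirrored-s₃ : ∀ {l} → All S l → length l ≡ e₃ → InV S middle (3 * n * sum l + 0)
    mirrored-s₃ Sl refl = subst (InV S middle) (sym (+-identityʳ _))
      (InV-middle-mirrored S0 Sl (≤-trans (<⇒≤ 2e₃<K) (n≤1+n K)))

  InV-bVec-multiple+w : ∀ q {j} → j ≤ K → InV S (bVec n e₁ e₂) (n * q + w j)
  InV-bVec-multiple+w q {j} j≤K = InV-bVec-via-aVec gap-at-j q
    where
    gap-at-j : ∀ {l} → All S l → length l ≡ e₃ → InV S middle (3 * n * sum l + w j)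
    gap-at-j {l} Sl refl
      with insertZero-⊓-clears j (K ∸ j) l (subst (e₃ + e₃ <_) (sym (m+[n∸m]≡n j≤K)) 2e₃<K)
    ... | lⱼ≡0 , lₖ₋ⱼ≡0 =
      subst (λ v → InV S middle (3 * n * v + w j)) (sum-insertZero p l)
        (InV-middle-mirrored+w S0 S1 (All-insertZero S0 p Sl) fits j≤K lⱼ≡0 lₖ₋ⱼ≡0)
      where
      p : ℕ
      p = j ⊓ (K ∸ j)
      fits : length (insertZero p l) + length (insertZero p l) ≤ suc K
      fits = ≤-trans (+-mono-≤ (length-insertZero p l) (length-insertZero p l))
        (subst (_≤ suc K) (sym (+-suc (suc e₃) e₃)) (s≤s 2e₃<K))

lemma2p2 : (S : NatSet) → S 0 → S 1 →
    (e₁ e₂ e₃ : ℕ) → 1 ≤ e₁ →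
    (∀ m → InV S (aVec e₁ e₂ e₃) m) →
    ∀ n → 2 * e₃ + 3 ≤ n →
    ∀ m → InV' S (bVec n e₁ e₂) m ⇔ n ≤ m
-- The hypothesis 1 ≤ e₁ is redundant: 1 ∈ V_S(a) already forces e₁ ≥ 1.
lemma2p2 S S0 S1 e₁ e₂ e₃ _ a-universal (suc (suc K)) 2e₃+3≤n m =
  mk⇔ (InV'-≥ (bVec-≥ e₁ e₂)) (λ n≤m → represent n≤m , λ { refl → <⇒≱ z<s n≤m })
  where
  open Middle K
  reshape : ∀ e → 2 * e + 3 ≡ suc (suc (suc (e + e)))
  reshape = solve-∀
  open Construction S S0 S1 e₁ e₂ e₃ a-universal K
    (≤-pred (≤-pred (subst (_≤ n) (reshape e₃) 2e₃+3≤n)))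
  represent : n ≤ m → InV S (bVec n e₁ e₂) m
  represent n≤m with ≥-divisor-cases n n≤m
  ... | inj₁ (q , refl)          = InV-bVec-multiple q
  ... | inj₂ (q , j , j<n , refl) = InV-bVec-multiple+w q (≤-pred (≤-pred j<n))
lemma2p2 _ _ _ _ _ e₃ _ _ zero       2e₃+3≤n = contradiction (≤-trans (m≤n+m 3 (2 * e₃)) 2e₃+3≤n) λ ()
lemma2p2 _ _ _ _ _ e₃ _ _ (suc zero) 2e₃+3≤n = contradiction (≤-trans (m≤n+m 3 (2 * e₃)) 2e₃+3≤n) λ { (s≤s ()) }
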